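{- For every even integer $n\geq 4$, $b_2(C_n) = \frac{n-2}{2}$.
   Context: $C_n$ denotes the cycle on $n$ vertices. For a finite simple graph $G=(V,E)$, a biclique on a subset of $V$ is given by two disjoint sets $X,Y\subseteq V$; its edges are all pairs $\{x,y\}$ with $x\in X$, $y\in Y$. An odd cover of $G$ is a collection of bicliques on subsets of $V$ such that every pair of vertices adjacent in $G$ is an edge of an odd number of the bicliques, and every pair of distinct non-adjacent vertices is an edge of an even number of the bicliques. $b_2(G)$ denotes the minimum cardinality of an odd cover of $G$. -}

module Defs where

open import Data.Nat using (ℕ; zero; suc; _∸_; _≤_; _%_)
open import Data.Fin using (Fin; toℕ)
open import Data.Bool using (Bool; true; false; _∧_; _∨_; not)
open import Data.List using (List; length; filter)
open import Data.Product using (Σ; _×_; ∃-syntax)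
open import Data.Sum using (_⊎_)
open import Relation.Binary.PropositionalEquality using (_≡_; _≢_)
open import Relation.Nullary using (¬_)
open import Relation.Nullary.Decidable using (does)
open import Function.Bundles using (_⇔_)
open import Data.Bool.Properties using (T?)
open import Data.Bool using (T)

Subset : ℕ → Set
Subset n = Fin n → Bool

record Biclique (n : ℕ) : Set where
  constructor biclique
  field
    X : Subset n
    Y : Subset n
    disjoint : ∀ v → X v ∧ Y v ≡ false

open Biclique public

isEdge : ∀ {n} → Biclique n → Fin n → Fin n → Bool
isEdge B u v = (X B u ∧ Y B v) ∨ (Y B u ∧ X B v)

edgeCount : ∀ {n} → List (Biclique n) → Fin n → Fin n → ℕ
edgeCount L u v = length (filter (λ B → T? (isEdge B u v)) L)

IsOddCover : ∀ {n} → (Fin n → Fin n → Set) → List (Biclique n) → Set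
IsOddCover {n} Adj L =
  ∀ (u v : Fin n) → u ≢ v →
    (Adj u v → edgeCount L u v % 2 ≡ 1) × (¬ Adj u v → edgeCount L u v % 2 ≡ 0)

B₂Is : ∀ {n} → (Fin n → Fin n → Set) → ℕ → Set
B₂Is {n} Adj k =
  (Σ (List (Biclique n)) λ L → IsOddCover Adj L × length L ≡ k)
  × (∀ (L : List (Biclique n)) → IsOddCover Adj L → k ≤ length L)

CycleAdj : (n : ℕ) → Fin n → Fin n → Set
CycleAdj n i j =
  toℕ j ≡ suc (toℕ i) ⊎ toℕ i ≡ suc (toℕ j)
  ⊎ (toℕ i ≡ 0 × toℕ j ≡ n ∸ 1) ⊎ (toℕ j ≡ 0 × toℕ i ≡ n ∸ 1)

-- Over F₂, a list of bicliques is an odd cover of G exactly when the matrices x yᵀ + y xᵀ of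
-- its bicliques (x, y the indicator vectors of the two sides) sum to the adjacency matrix A
-- of G. Hence cᵀA depends on c only through the 2ℓ pairings ⟨x, c⟩, ⟨y, c⟩. On the cycle,
-- (cᵀA)ᵥ = c_{v-1} + c_{v+1} at every interior vertex, so cᵀA determines each of the 2^(n-2)
-- vectors with c₀ = c₁ = 0, and n − 2 ≤ 2ℓ. Conversely C_{n+2} is the sum of a copy of C_n on
-- the vertices 2, …, n+1 and of the 4-cycle 0, 1, 2, n+1, which is the biclique {0, 2} × {1, n+1};
-- starting from C₄, this yields an odd cover of C_n by (n − 2)/2 bicliques.
module Submission where

open import Defs
open import Algebra.Bundles using (CommutativeMonoid; CommutativeRing)
import Algebra.Properties.CommutativeSemigroup as CommutativeSemigroupProperties
import Algebra.Properties.Semiring.Sum as SemiringSum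
open import Data.Bool using (Bool; true; false; _∧_; _∨_; _xor_; not)
open import Data.Bool.Properties
  using ( xor-∧-commutativeRing; ∧-commutativeMonoid; ∧-comm; ∧-zeroʳ; ∧-identityʳ; ∧-distribʳ-xor
        ; ∨-identityʳ; xor-identityʳ; not-injective)
  renaming (_≟_ to _≟ᵇ_)
open import Data.Fin using (Fin; zero; suc; toℕ; inject₁; combine; finToFun; funToFin)
open import Data.Fin.Properties
  using (toℕ-inject₁-≢; combine-injective; funToFin-finToFin; injective⇒≤; all?; 2↔Bool)
  renaming (_≟_ to _≟ᶠ_)
open import Data.List using (List; []; _∷_; length; map)
open import Data.List.Properties using (length-map)
open import Data.Nat using (ℕ; zero; suc; _+_; _*_; _^_; _∸_; _/_; _%_; _≤_; _<_; z≤n; s≤s)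
open import Data.Nat.Divisibility using (_∣_; divides)
open import Data.Nat.DivMod using (m*n/n≡m)
open import Data.Nat.Properties
  using (_≟_; 0≢1+n; 1+n≢n; suc-injective; ≮⇒≥; <⇒≱; ^-monoʳ-<; ^-*-assoc; *-comm; *-cancelʳ-≤)
open import Data.Product using (_×_; _,_; proj₁; proj₂)
open import Data.Sum using (_⊎_; inj₁; inj₂; assocʳ; assocˡ)
open import Data.Unit using (tt)
open import Function using (_∘_)
open import Function.Bundles using (_⇔_; mk⇔; Equivalence; _↣_; Injection)
open import Function.Properties.Inverse using (↔-sym; ↔⇒↣)
open import Relation.Binary.Definitions using (Decidable; Irreflexive)
open import Relation.Binary.PropositionalEquality
open import Relation.Nullary using (Dec; does; yes; no)
open import Relation.Nullary.Decidable using (_⊎-dec_; _×-dec_; map′; dec-true; dec-false; toWitness)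

open SemiringSum (CommutativeRing.semiring xor-∧-commutativeRing)
  using (sum; ∑-distrib-+; *-distribˡ-sum; sum-cong-≗; sum-replicate-zero)
open CommutativeSemigroupProperties (CommutativeMonoid.commutativeSemigroup ∧-commutativeMonoid)
  using (xy∙z≈y∙xz)

xor-cancelˡ : ∀ x {y z} → x xor y ≡ x xor z → y ≡ z
xor-cancelˡ false e = e
xor-cancelˡ true e = not-injective e

∨-disjoint≡xor : ∀ x y z w → x ∧ y ≡ false → (x ∧ z) ∨ (y ∧ w) ≡ (x ∧ z) xor (y ∧ w)
∨-disjoint≡xor false y z w _ = refl
∨-disjoint≡xor true false z w _ = trans (∨-identityʳ z) (sym (xor-identityʳ z))

∨-xor-absorb : ∀ p c → p ∧ c ≡ false → p ∨ false ≡ c xor (p ∨ c)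
∨-xor-absorb false false _ = refl
∨-xor-absorb false true _ = refl
∨-xor-absorb true false _ = refl

Matrix : ℕ → Set
Matrix n = Fin n → Fin n → Bool

_·_ : ∀ {n} → Matrix n → (Fin n → Bool) → Fin n → Bool
(M · c) v = sum λ u → M u v ∧ c u

⟨_,_⟩ : ∀ {n} → Subset n → (Fin n → Bool) → Bool
⟨ S , c ⟩ = sum λ u → S u ∧ c u

·-cong : ∀ {n} {M N : Matrix n} → (∀ u v → M u v ≡ N u v) → ∀ c v → (M · c) v ≡ (N · c) v
·-cong M≡N c v = sum-cong-≗ λ u → cong (_∧ c u) (M≡N u v)

·-distrib-xor : ∀ {n} (M N : Matrix n) c v →
                ((λ u v → M u v xor N u v) · c) v ≡ (M · c) v xor (N · c) v
·-distrib-xor M N c v =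
  trans (sum-cong-≗ λ u → ∧-distribʳ-xor (c u) (M u v) (N u v))
        (∑-distrib-+ (λ u → M u v ∧ c u) (λ u → N u v ∧ c u))

parity : ∀ {n} → List (Biclique n) → Matrix n
parity [] u v = false
parity (B ∷ L) u v = isEdge B u v xor parity L u v

bit : Bool → ℕ
bit false = 0
bit true = 1

bit-injective : ∀ {x y} → bit x ≡ bit y → x ≡ y
bit-injective {false} {false} _ = refl
bit-injective {true} {true} _ = refl

suc-%2 : ∀ m {b} → m % 2 ≡ bit b → suc m % 2 ≡ bit (not b)
suc-%2 zero {false} refl = refl
suc-%2 (suc zero) {true} refl = refl
suc-%2 (suc (suc m)) e = suc-%2 m e

edgeCount-%2 : ∀ {n} (L : List (Biclique n)) u v → edgeCount L u v % 2 ≡ bit (parity L u v)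
edgeCount-%2 [] u v = refl
edgeCount-%2 (B ∷ L) u v with isEdge B u v
... | true = suc-%2 (edgeCount L u v) (edgeCount-%2 L u v)
... | false = edgeCount-%2 L u v

parity-diagonal : ∀ {n} (L : List (Biclique n)) v → parity L v v ≡ false
parity-diagonal [] v = refl
parity-diagonal (B ∷ L) v =
  cong₂ _xor_ (cong₂ _∨_ (disjoint B v) (trans (∧-comm (Y B v) (X B v)) (disjoint B v)))
              (parity-diagonal L v)

isOddCover⇔parity : ∀ {n} {Adj : Fin n → Fin n → Set} (adj? : Decidable Adj) → Irreflexive _≡_ Adj →
                    ∀ L → IsOddCover Adj L ⇔ (∀ u v → parity L u v ≡ does (adj? u v))
isOddCover⇔parity {Adj = Adj} adj? irrefl L = mk⇔ to from
  where
  to : IsOddCover Adj L → ∀ u v → parity L u v ≡ does (adj? u v)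
  to oc u v with u ≟ᶠ v
  ... | yes refl = trans (parity-diagonal L u) (sym (dec-false (adj? u u) (irrefl refl)))
  ... | no u≢v with adj? u v
  ...   | yes a = bit-injective (trans (sym (edgeCount-%2 L u v)) (proj₁ (oc u v u≢v) a))
  ...   | no ¬a = bit-injective (trans (sym (edgeCount-%2 L u v)) (proj₂ (oc u v u≢v) ¬a))
  from : (∀ u v → parity L u v ≡ does (adj? u v)) → IsOddCover Adj L
  from p u v _ =
    (λ a → trans (edgeCount-%2 L u v) (cong bit (trans (p u v) (dec-true (adj? u v) a)))) ,
    (λ ¬a → trans (edgeCount-%2 L u v) (cong bit (trans (p u v) (dec-false (adj? u v) ¬a))))

isEdge-· : ∀ {n} (B : Biclique n) c v →
           (isEdge B · c) v ≡ (Y B v ∧ ⟨ X B , c ⟩) xor (X B v ∧ ⟨ Y B , c ⟩)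
isEdge-· B c v = begin
  (isEdge B · c) v
    ≡⟨ sum-cong-≗ pointwise ⟩
  sum (λ u → (Y B v ∧ (X B u ∧ c u)) xor (X B v ∧ (Y B u ∧ c u)))
    ≡⟨ ∑-distrib-+ (λ u → Y B v ∧ (X B u ∧ c u)) (λ u → X B v ∧ (Y B u ∧ c u)) ⟩
  sum (λ u → Y B v ∧ (X B u ∧ c u)) xor sum (λ u → X B v ∧ (Y B u ∧ c u))
    ≡⟨ sym (cong₂ _xor_ (*-distribˡ-sum (Y B v) λ u → X B u ∧ c u)
                        (*-distribˡ-sum (X B v) λ u → Y B u ∧ c u)) ⟩
  (Y B v ∧ ⟨ X B , c ⟩) xor (X B v ∧ ⟨ Y B , c ⟩) ∎
  where
  open ≡-Reasoning
  pointwise : ∀ u → isEdge B u v ∧ c u ≡ (Y B v ∧ (X B u ∧ c u)) xor (X B v ∧ (Y B u ∧ c u))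
  pointwise u = begin
    isEdge B u v ∧ c u
      ≡⟨ cong (_∧ c u) (∨-disjoint≡xor (X B u) (Y B u) (Y B v) (X B v) (disjoint B u)) ⟩
    ((X B u ∧ Y B v) xor (Y B u ∧ X B v)) ∧ c u
      ≡⟨ ∧-distribʳ-xor (c u) (X B u ∧ Y B v) (Y B u ∧ X B v) ⟩
    ((X B u ∧ Y B v) ∧ c u) xor ((Y B u ∧ X B v) ∧ c u)
      ≡⟨ cong₂ _xor_ (xy∙z≈y∙xz (X B u) (Y B v) (c u)) (xy∙z≈y∙xz (Y B u) (X B v) (c u)) ⟩
    (Y B v ∧ (X B u ∧ c u)) xor (X B v ∧ (Y B u ∧ c u)) ∎

parity-∷-· : ∀ {n} (B : Biclique n) L c v →
             (parity (B ∷ L) · c) v ≡ ((Y B v ∧ ⟨ X B , c ⟩) xor (X B v ∧ ⟨ Y B , c ⟩)) xor (parity L · c) v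
parity-∷-· B L c v =
  trans (·-distrib-xor (isEdge B) (parity L) c v) (cong (_xor (parity L · c) v) (isEdge-· B c v))

Bool↣Fin2 : Bool ↣ Fin 2
Bool↣Fin2 = ↔⇒↣ (↔-sym 2↔Bool)

signature : ∀ {n} (L : List (Biclique n)) → (Fin n → Bool) → Fin (4 ^ length L)
signature [] c = zero
signature (B ∷ L) c =
  combine (combine (Injection.to Bool↣Fin2 ⟨ X B , c ⟩) (Injection.to Bool↣Fin2 ⟨ Y B , c ⟩)) (signature L c)

signature-· : ∀ {n} (L : List (Biclique n)) {c c'} → signature L c ≡ signature L c' →
              ∀ v → (parity L · c) v ≡ (parity L · c') v
signature-· [] e v = refl
signature-· (B ∷ L) {c} {c'} e v with combine-injective _ _ _ _ e
... | eXY , eL with combine-injective _ _ _ _ eXY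
...   | eX , eY = begin
  (parity (B ∷ L) · c) v
    ≡⟨ parity-∷-· B L c v ⟩
  ((Y B v ∧ ⟨ X B , c ⟩) xor (X B v ∧ ⟨ Y B , c ⟩)) xor (parity L · c) v
    ≡⟨ cong₂ _xor_ (cong₂ (λ x y → (Y B v ∧ x) xor (X B v ∧ y))
                          (Injection.injective Bool↣Fin2 eX) (Injection.injective Bool↣Fin2 eY))
                   (signature-· L eL v) ⟩
  ((Y B v ∧ ⟨ X B , c' ⟩) xor (X B v ∧ ⟨ Y B , c' ⟩)) xor (parity L · c') v
    ≡⟨ sym (parity-∷-· B L c' v) ⟩
  (parity (B ∷ L) · c') v ∎
  where open ≡-Reasoning

funToFin-cong : ∀ {m n} {f g : Fin m → Fin n} → (∀ i → f i ≡ g i) → funToFin f ≡ funToFin g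
funToFin-cong {zero} _ = refl
funToFin-cong {suc m} f≗g = cong₂ combine (f≗g zero) (funToFin-cong (f≗g ∘ suc))

finToFun-injective : ∀ {m n} {i j : Fin (m ^ n)} → (∀ k → finToFun i k ≡ finToFun j k) → i ≡ j
finToFun-injective {m} {n} {i} {j} i≗j =
  trans (sym (funToFin-finToFin {n} {m} i))
        (trans (funToFin-cong {n} {m} i≗j) (funToFin-finToFin {n} {m} j))

injective⇒2^≤ : ∀ {m k} (f : (Fin m → Bool) → Fin k) → (∀ x y → f x ≡ f y → ∀ i → x i ≡ y i) →
                2 ^ m ≤ k
injective⇒2^≤ {m} f f-inj =
  injective⇒≤ {f = f ∘ bits} λ e → finToFun-injective λ i → Injection.injective Fin2↣Bool (f-inj _ _ e i)
  where
  Fin2↣Bool = ↔⇒↣ 2↔Bool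
  bits : Fin (2 ^ m) → Fin m → Bool
  bits i k = Injection.to Fin2↣Bool (finToFun i k)

^-cancelˡ-≤ : ∀ b {m n} → 1 < b → b ^ m ≤ b ^ n → m ≤ n
^-cancelˡ-≤ b 1<b le = ≮⇒≥ λ n<m → <⇒≱ (^-monoʳ-< b 1<b n<m) le

path? : ∀ {n} (u v : Fin n) → Dec (toℕ v ≡ suc (toℕ u) ⊎ toℕ u ≡ suc (toℕ v))
path? u v = toℕ v ≟ suc (toℕ u) ⊎-dec toℕ u ≟ suc (toℕ v)

closing? : ∀ {n} (u v : Fin n) → Dec ((toℕ u ≡ 0 × toℕ v ≡ n ∸ 1) ⊎ (toℕ v ≡ 0 × toℕ u ≡ n ∸ 1))
closing? {n} u v = (toℕ u ≟ 0 ×-dec toℕ v ≟ n ∸ 1) ⊎-dec (toℕ v ≟ 0 ×-dec toℕ u ≟ n ∸ 1)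

cycle? : ∀ n → Decidable (CycleAdj n)
cycle? n u v = map′ assocʳ assocˡ (path? u v ⊎-dec closing? u v)

pathᵇ cycleᵇ : ∀ {n} → Matrix n
pathᵇ u v = does (path? u v)
cycleᵇ {n} u v = does (cycle? n u v)

cycle-irreflexive : ∀ {m} → Irreflexive _≡_ (CycleAdj (2 + m))
cycle-irreflexive refl (inj₁ e) = 1+n≢n (sym e)
cycle-irreflexive refl (inj₂ (inj₁ e)) = 1+n≢n (sym e)
cycle-irreflexive refl (inj₂ (inj₂ (inj₁ (z , l)))) = 0≢1+n (trans (sym z) l)
cycle-irreflexive refl (inj₂ (inj₂ (inj₂ (z , l)))) = 0≢1+n (trans (sym z) l)

path∧closing : ∀ {k} (u v : Fin (3 + k)) → pathᵇ u v ∧ does (closing? u v) ≡ false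
path∧closing u v = dec-false (path? u v ×-dec closing? u v) λ where
  (inj₁ e , inj₁ (z , l)) → 0≢1+n (suc-injective (trans (cong suc (sym z)) (trans (sym e) l)))
  (inj₁ e , inj₂ (z , _)) → 0≢1+n (trans (sym z) e)
  (inj₂ e , inj₁ (z , _)) → 0≢1+n (trans (sym z) e)
  (inj₂ e , inj₂ (z , l)) → 0≢1+n (suc-injective (trans (cong suc (sym z)) (trans (sym e) l)))

closing-interior : ∀ {n} (u : Fin (2 + n)) (w : Fin n) → does (closing? u (suc (inject₁ w))) ≡ false
closing-interior u w = dec-false (closing? u (suc (inject₁ w))) λ where
  (inj₁ (_ , l)) → toℕ-inject₁-≢ w (sym (suc-injective l))
  (inj₂ (() , _))

path-· : ∀ {n} (c : Fin (2 + n) → Bool) (w : Fin n) →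
         (pathᵇ · c) (suc (inject₁ w)) ≡ c (inject₁ (inject₁ w)) xor c (suc (suc w))
path-· {suc n} c zero =
  cong (c zero xor_) (trans (cong (c (suc (suc zero)) xor_) (sum-replicate-zero n)) (xor-identityʳ _))
path-· c (suc w) = path-· (c ∘ suc) w

cycle-· : ∀ {n} (c : Fin (2 + n) → Bool) (w : Fin n) →
          (cycleᵇ · c) (suc (inject₁ w)) ≡ c (inject₁ (inject₁ w)) xor c (suc (suc w))
cycle-· c w = trans (sum-cong-≗ λ u → cong (_∧ c u) (cycle≡path u)) (path-· c w)
  where
  cycle≡path : ∀ u → cycleᵇ u (suc (inject₁ w)) ≡ pathᵇ u (suc (inject₁ w))
  cycle≡path u = trans (cong (pathᵇ u (suc (inject₁ w)) ∨_) (closing-interior u w)) (∨-identityʳ _)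

determined-by-neighbour-sums :
  ∀ {n} {c c' : Fin (2 + n) → Bool} → c zero ≡ c' zero → c (suc zero) ≡ c' (suc zero) →
  (∀ w → c (inject₁ (inject₁ w)) xor c (suc (suc w)) ≡ c' (inject₁ (inject₁ w)) xor c' (suc (suc w))) →
  ∀ u → c u ≡ c' u
determined-by-neighbour-sums {zero} e₀ e₁ h zero = e₀
determined-by-neighbour-sums {zero} e₀ e₁ h (suc zero) = e₁
determined-by-neighbour-sums {suc n} e₀ e₁ h zero = e₀
determined-by-neighbour-sums {suc n} {c} {c'} e₀ e₁ h (suc u) =
  determined-by-neighbour-sums {n} {c ∘ suc} {c' ∘ suc} e₁ e₂ (h ∘ suc) u
  where
  e₂ : c (suc (suc zero)) ≡ c' (suc (suc zero))
  e₂ = xor-cancelˡ (c zero) (trans (h zero) (cong (_xor c' (suc (suc zero))) (sym e₀)))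

pad₂ : ∀ {n} → (Fin n → Bool) → Fin (2 + n) → Bool
pad₂ c zero = false
pad₂ c (suc zero) = false
pad₂ c (suc (suc u)) = c u

cycle-lower-bound : ∀ {m} (L : List (Biclique (2 + m))) → (∀ u v → parity L u v ≡ cycleᵇ u v) →
                    m ≤ 2 * length L
cycle-lower-bound {m} L L≡C = ^-cancelˡ-≤ 2 (s≤s (s≤s z≤n))
  (subst (2 ^ m ≤_) (^-*-assoc 2 2 (length L)) (injective⇒2^≤ (signature L ∘ pad₂) injective))
  where
  neighbourSum : ∀ x w → pad₂ x (inject₁ (inject₁ w)) xor pad₂ x (suc (suc w))
                         ≡ (parity L · pad₂ x) (suc (inject₁ w))
  neighbourSum x w = trans (sym (cycle-· (pad₂ x) w)) (·-cong (λ u v → sym (L≡C u v)) (pad₂ x) _)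
  injective : ∀ x y → signature L (pad₂ x) ≡ signature L (pad₂ y) → ∀ i → x i ≡ y i
  injective x y e i = determined-by-neighbour-sums {c = pad₂ x} {c' = pad₂ y} refl refl
    (λ w → trans (neighbourSum x w) (trans (signature-· L e _) (sym (neighbourSum y w))))
    (suc (suc i))

lift : ∀ {n} → Biclique n → Biclique (2 + n)
lift B = biclique (pad₂ (X B)) (pad₂ (Y B)) pad₂-disjoint
  where
  pad₂-disjoint : ∀ v → pad₂ (X B) v ∧ pad₂ (Y B) v ≡ false
  pad₂-disjoint zero = refl
  pad₂-disjoint (suc zero) = refl
  pad₂-disjoint (suc (suc v)) = disjoint B v

padMatrix : ∀ {n} → Matrix n → Matrix (2 + n)
padMatrix M (suc (suc u)) (suc (suc v)) = M u v
padMatrix M _ _ = false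

padMatrix-cong : ∀ {n} {M N : Matrix n} → (∀ u v → M u v ≡ N u v) →
                 ∀ u v → padMatrix M u v ≡ padMatrix N u v
padMatrix-cong M≡N (suc (suc u)) (suc (suc v)) = M≡N u v
padMatrix-cong M≡N zero v = refl
padMatrix-cong M≡N (suc zero) v = refl
padMatrix-cong M≡N (suc (suc u)) zero = refl
padMatrix-cong M≡N (suc (suc u)) (suc zero) = refl

parity-lift : ∀ {n} (L : List (Biclique n)) u v → parity (map lift L) u v ≡ padMatrix (parity L) u v
parity-lift [] (suc (suc u)) (suc (suc v)) = refl
parity-lift [] zero v = refl
parity-lift [] (suc zero) v = refl
parity-lift [] (suc (suc u)) zero = refl
parity-lift [] (suc (suc u)) (suc zero) = refl
parity-lift (B ∷ L) (suc (suc u)) (suc (suc v)) =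
  cong (isEdge B u v xor_) (parity-lift L (suc (suc u)) (suc (suc v)))
parity-lift (B ∷ L) zero v = parity-lift L zero v
parity-lift (B ∷ L) (suc zero) v = parity-lift L (suc zero) v
parity-lift (B ∷ L) (suc (suc u)) zero =
  cong₂ _xor_ (cong₂ _∨_ (∧-zeroʳ (X B u)) (∧-zeroʳ (Y B u))) (parity-lift L (suc (suc u)) zero)
parity-lift (B ∷ L) (suc (suc u)) (suc zero) =
  cong₂ _xor_ (cong₂ _∨_ (∧-zeroʳ (X B u)) (∧-zeroʳ (Y B u))) (parity-lift L (suc (suc u)) (suc zero))

-- The 4-cycle 0, 1, 2, 3+k as the biclique {0, 2} × {1, 3+k}.
fourCycle : ∀ {k} → Biclique (4 + k)
fourCycle {k} = biclique zeroOrTwo oneOrLast disjoint₄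
  where
  zeroOrTwo oneOrLast : Subset (4 + k)
  zeroOrTwo zero = true
  zeroOrTwo (suc zero) = false
  zeroOrTwo (suc (suc u)) = does (toℕ u ≟ 0)
  oneOrLast zero = false
  oneOrLast (suc zero) = true
  oneOrLast (suc (suc u)) = does (toℕ u ≟ suc k)
  disjoint₄ : ∀ v → zeroOrTwo v ∧ oneOrLast v ≡ false
  disjoint₄ zero = refl
  disjoint₄ (suc zero) = refl
  disjoint₄ (suc (suc u)) = dec-false (toℕ u ≟ 0 ×-dec toℕ u ≟ suc k) λ (z , l) → 0≢1+n (trans (sym z) l)

-- Most cases hold by evaluation: does (m ≟ n) computes to m ≡ᵇ n, which is invariant under
-- shifting both sides.
cycleᵇ-decompose : ∀ {k} (u v : Fin (5 + k)) → cycleᵇ u v ≡ isEdge fourCycle u v xor padMatrix cycleᵇ u v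
cycleᵇ-decompose zero zero = refl
cycleᵇ-decompose zero (suc zero) = refl
cycleᵇ-decompose zero (suc (suc v)) = sym (xor-identityʳ _)
cycleᵇ-decompose (suc zero) zero = refl
cycleᵇ-decompose (suc zero) (suc zero) = refl
cycleᵇ-decompose (suc zero) (suc (suc zero)) = refl
cycleᵇ-decompose (suc zero) (suc (suc (suc v))) = refl
cycleᵇ-decompose (suc (suc zero)) zero = refl
cycleᵇ-decompose (suc (suc (suc u))) zero = sym (trans (xor-identityʳ _) (∧-identityʳ _))
cycleᵇ-decompose (suc (suc zero)) (suc zero) = refl
cycleᵇ-decompose {k} (suc (suc (suc u))) (suc zero) =
  sym (trans (xor-identityʳ _) (∧-zeroʳ (does (toℕ u ≟ suc k))))
cycleᵇ-decompose {k} (suc (suc u)) (suc (suc v)) =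
  trans (∨-xor-absorb (pathᵇ u v) (does (closing? u v)) (path∧closing u v))
        (cong (λ b → (isZero u ∧ isLast v ∨ b) xor cycleᵇ u v) (∧-comm (isZero v) (isLast u)))
  where
  isZero isLast : Fin (3 + k) → Bool
  isZero w = does (toℕ w ≟ 0)
  isLast w = does (toℕ w ≟ suc (suc k))

cycleCover : ∀ K → List (Biclique (4 + K * 2))
cycleCover zero = fourCycle ∷ []
cycleCover (suc K) = fourCycle ∷ map lift (cycleCover K)

length-cycleCover : ∀ K → length (cycleCover K) ≡ suc K
length-cycleCover zero = refl
length-cycleCover (suc K) = cong suc (trans (length-map lift (cycleCover K)) (length-cycleCover K))

cycleCover-parity : ∀ K u v → parity (cycleCover K) u v ≡ cycleᵇ u v
cycleCover-parity zero =
  toWitness {a? = all? λ u → all? λ v → parity (cycleCover 0) u v ≟ᵇ cycleᵇ u v} tt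
cycleCover-parity (suc K) u v = begin
  isEdge fourCycle u v xor parity (map lift (cycleCover K)) u v
    ≡⟨ cong (isEdge fourCycle u v xor_) (parity-lift (cycleCover K) u v) ⟩
  isEdge fourCycle u v xor padMatrix (parity (cycleCover K)) u v
    ≡⟨ cong (isEdge fourCycle u v xor_) (padMatrix-cong (cycleCover-parity K) u v) ⟩
  isEdge fourCycle u v xor padMatrix cycleᵇ u v
    ≡⟨ sym (cycleᵇ-decompose u v) ⟩
  cycleᵇ u v ∎
  where open ≡-Reasoning

b₂-cycle : ∀ K → B₂Is (CycleAdj (4 + K * 2)) (suc K)
b₂-cycle K = (cycleCover K , cover , length-cycleCover K) , minimal
  where
  oddCover⇔parity : ∀ L → IsOddCover (CycleAdj (4 + K * 2)) L ⇔ (∀ u v → parity L u v ≡ cycleᵇ u v)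
  oddCover⇔parity = isOddCover⇔parity (cycle? (4 + K * 2)) cycle-irreflexive
  cover : IsOddCover (CycleAdj (4 + K * 2)) (cycleCover K)
  cover = Equivalence.from (oddCover⇔parity (cycleCover K)) (cycleCover-parity K)
  minimal : ∀ L → IsOddCover (CycleAdj (4 + K * 2)) L → suc K ≤ length L
  minimal L oc = *-cancelʳ-≤ (suc K) (length L) 2 (subst (suc K * 2 ≤_) (*-comm 2 (length L))
    (cycle-lower-bound L (Equivalence.to (oddCover⇔parity L) oc)))

corollary4p5 : ∀ (n : ℕ) → 4 ≤ n → 2 ∣ n → B₂Is (CycleAdj n) ((n ∸ 2) / 2)
corollary4p5 .(1 * 2) (s≤s (s≤s ())) (divides (suc zero) refl)
corollary4p5 .(suc (suc K) * 2) _ (divides (suc (suc K)) refl) =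
  subst (B₂Is (CycleAdj (4 + K * 2))) (sym (m*n/n≡m (suc K) 2)) (b₂-cycle K)
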